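{- Let $G$ be a connected graph and let $\mathcal{E}=\{E_1,\ldots,E_m\}$ be a locally connected partition of the edge set of the double graph $\widehat{G}$. Then there do not exist a vertex $v$ of $G$, an index $j\in\{1,\ldots,m\}$, and a partition $\{F_1,F_2\}$ of the set of edges of $G$ incident to $v$ with $F_1\neq\emptyset$ and $F_2\neq\emptyset$, such that both copies of every edge in $F_1$ belong to $E_j$ and no copy of any edge in $F_2$ belongs to $E_j$.
   Context: Graphs are finite and undirected, with loops and multiple edges allowed. The double graph $\widehat{G}$ of $G$ is obtained by replacing each edge $e$ by two copies $e',e''$. For a partition $\mathcal{E}=\{E_1,\ldots,E_m\}$ of the edge set of $\widehat{G}$ and a vertex $v$ of $G$, let $H^{\mathcal{E}}_v$ be the graph with vertex set $\{j : \text{some edge of } E_j \text{ is incident with } v\}$ in which distinct $j,k$ are adjacent whenever some edge $e$ of $G$ incident with $v$ has one copy in $E_j$ and the other in $E_k$. The partition is locally connected if $H^{\mathcal{E}}_v$ is connected for every vertex $v$ of $G$. -}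

module Defs where

open import Data.Nat using (ℕ)
open import Data.Fin using (Fin)
open import Data.Bool using (Bool; true; false)
open import Data.Product using (Σ; ∃; ∃-syntax; _×_; _,_; proj₁; proj₂)
open import Data.Sum using (_⊎_)
open import Relation.Binary.PropositionalEquality using (_≡_; _≢_)
open import Relation.Binary.Construct.Closure.ReflexiveTransitive using (Star)

-- A finite multigraph (loops and parallel edges allowed):
-- vertices Fin n, edges Fin k, each edge has an (unordered) pair of endpoints,
-- stored as an ordered pair whose order carries no meaning.
record Graph : Set where
  field
    n    : ℕ
    k    : ℕ
    ends : Fin k → Fin n × Fin n

open Graph public

Vertex : Graph → Set
Vertex G = Fin (n G)

Edge : Graph → Set
Edge G = Fin (k G)

Incident : (G : Graph) → Vertex G → Edge G → Set
Incident G v e = proj₁ (ends G e) ≡ v ⊎ proj₂ (ends G e) ≡ v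

Adjacent : (G : Graph) → Vertex G → Vertex G → Set
Adjacent G u w = ∃[ e ] (ends G e ≡ (u , w) ⊎ ends G e ≡ (w , u))

Connected : Graph → Set
Connected G = ∀ (u w : Vertex G) → Star (Adjacent G) u w

-- The double graph Ĝ has edge set Edge G × Bool: (e , false) = e′, (e , true) = e″.
-- A partition of E(Ĝ) into m classes E_1..E_m is a map assigning each edge of Ĝ
-- its class; the classes must be nonempty (surjectivity).
EdgeClassing : Graph → ℕ → Set
EdgeClassing G m = Edge G → Bool → Fin m

IsPartition : (G : Graph) (m : ℕ) → EdgeClassing G m → Set
IsPartition G m c = ∀ (j : Fin m) → ∃[ e ] ∃[ b ] (c e b ≡ j)

module _ (G : Graph) {m : ℕ} (c : EdgeClassing G m) (v : Vertex G) where

  InH : Fin m → Set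
  InH j = ∃[ e ] (Incident G v e × ∃[ b ] (c e b ≡ j))

  AdjH : Fin m → Fin m → Set
  AdjH j j' = j ≢ j' × ∃[ e ] (Incident G v e ×
                 ((c e false ≡ j × c e true ≡ j') ⊎ (c e false ≡ j' × c e true ≡ j)))

  HConnected : Set
  HConnected = ∀ j j' → InH j → InH j' → Star AdjH j j'

LocallyConnected : (G : Graph) {m : ℕ} → EdgeClassing G m → Set
LocallyConnected G c = ∀ (v : Vertex G) → HConnected G c v

module Submission where

-- Suppose at a vertex v the edges split into a nonempty
-- set F₁ whose two copies both lie in the class E_j and a nonempty set F₂
-- with no copy in E_j.  Then no edge at v has exactly one copy in E_j, so j
-- has no neighbour in the local graph H_v: it is an isolated vertex of H_v.
-- But H_v also contains the class of a copy of an edge of F₂, which differs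
-- from j; local connectivity would give a path in H_v from j to it, and a
-- path starting at an isolated vertex never leaves it.  Contradiction.

open import Defs
open import Data.Nat using (ℕ)
open import Data.Fin using (Fin)
open import Data.Fin.Subset using (Subset; _∈_)
open import Data.Bool using (true; false)
open import Data.Product using (Σ; ∃; ∃-syntax; _×_; _,_)
open import Data.Sum using (_⊎_; inj₁; inj₂)
open import Data.Empty using (⊥; ⊥-elim)
open import Relation.Nullary using (¬_)
open import Relation.Binary.PropositionalEquality using (_≡_; _≢_; refl; sym; trans)
open import Relation.Binary.Construct.Closure.ReflexiveTransitive using (Star; ε; _◅_)

walk-from-isolated : ∀ {A : Set} {R : A → A → Set} {x y : A} →
                     (∀ z → ¬ R x z) → Star R x y → y ≡ x
walk-from-isolated isolated ε          = refl
walk-from-isolated isolated (step ◅ _) = ⊥-elim (isolated _ step)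

unsplit-class-isolated :
  (G : Graph) {m : ℕ} (c : EdgeClassing G m) (v : Vertex G) (j : Fin m) →
  (∀ e → Incident G v e → (∀ b → c e b ≡ j) ⊎ (∀ b → c e b ≢ j)) →
  ∀ j' → ¬ AdjH G c v j j'
unsplit-class-isolated G c v j unsplit j' (j≢j' , e , inc , copies)
  with unsplit e inc | copies
... | inj₁ both | inj₁ (_ , true≡j')  = j≢j' (trans (sym (both true)) true≡j')
... | inj₁ both | inj₂ (false≡j' , _) = j≢j' (trans (sym (both false)) false≡j')
... | inj₂ none | inj₁ (false≡j , _)  = none false false≡j
... | inj₂ none | inj₂ (_ , true≡j)   = none true true≡j

lemma6p1 : (G : Graph) → Connected G → (m : ℕ) → (c : EdgeClassing G m) →
    IsPartition G m c → LocallyConnected G c →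
    ¬ (Σ (Vertex G) λ v → Σ (Fin m) λ j → Σ (Subset (k G)) λ F₁ → Σ (Subset (k G)) λ F₂ →
    (∀ e → Incident G v e → e ∈ F₁ ⊎ e ∈ F₂) ×
    (∀ e → e ∈ F₁ → Incident G v e) ×
    (∀ e → e ∈ F₂ → Incident G v e) ×
    (∀ e → e ∈ F₁ → e ∈ F₂ → ⊥) ×
    (∃[ e ] (e ∈ F₁)) × (∃[ e ] (e ∈ F₂)) ×
    (∀ e → e ∈ F₁ → ∀ b → c e b ≡ j) ×
    (∀ e → e ∈ F₂ → ∀ b → c e b ≢ j))
lemma6p1 G _ m c _ locallyConnected
  (v , j , F₁ , F₂ , cover , F₁-at-v , F₂-at-v , _ , (e₁ , e₁∈F₁) , (e₂ , e₂∈F₂) , inside , outside) =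
  outside e₂ e₂∈F₂ false (walk-from-isolated j-isolated path)
  where
    unsplit : ∀ e → Incident G v e → (∀ b → c e b ≡ j) ⊎ (∀ b → c e b ≢ j)
    unsplit e inc with cover e inc
    ... | inj₁ e∈F₁ = inj₁ (inside e e∈F₁)
    ... | inj₂ e∈F₂ = inj₂ (outside e e∈F₂)

    j-isolated : ∀ j' → ¬ AdjH G c v j j'
    j-isolated = unsplit-class-isolated G c v j unsplit

    path : Star (AdjH G c v) j (c e₂ false)
    path = locallyConnected v j (c e₂ false)
             (e₁ , F₁-at-v e₁ e₁∈F₁ , false , inside e₁ e₁∈F₁ false)
             (e₂ , F₂-at-v e₂ e₂∈F₂ , false , refl)
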